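{- Let $\Sigma$ be an alphabet, $\#\notin\Sigma$, let $y_1,y_2$ be words over $\Sigma$, let $y_3=y_1\#y_2$, and let $\ell$ be a positive integer. Let $x\in\mathcal{M}^{\ell}_{y_3}\setminus(\mathcal{M}^{\ell}_{y_1}\cup\mathcal{M}^{\ell}_{y_2})$. Then there exist $i,j$ with $\{i,j\}=\{1,2\}$ such that $x$ has a prefix in $\mathcal{RM}^{\ell}_{y_i}$ and a suffix in $\mathcal{RM}^{\ell}_{y_j}$.
   Context: For a word $y$ (over $\Sigma$, possibly also containing the separator $\#\notin\Sigma$), the set of minimal absent words of $y$ is $\mathcal{M}_y=\{aub : a,b\in\Sigma,\ u\in\Sigma^*,\ au \text{ and } ub \text{ are factors of } y \text{ but } aub \text{ is not}\}\cup\{c\in\Sigma : c \text{ does not occur in } y\}$. For $\ell>0$, $\mathcal{M}^{\ell}_y=\mathcal{M}_y\cap\Sigma^{\le \ell}$, where $\Sigma^{\le\ell}$ is the set of words over $\Sigma$ of length at most $\ell$. A word $w$ is a superword of $x$ if $x$ is a factor of $w$. The reduced set $\mathcal{RM}^{\ell}_{y_1}$ (of $y_1$ with respect to $y_2$) is the set obtained from $\mathcal{M}^{\ell}_{y_1}$ by removing those words that are superwords of some word in $\mathcal{M}^{\ell}_{y_2}$; $\mathcal{RM}^{\ell}_{y_2}$ (of $y_2$ with respect to $y_1$) is defined analogously by removing from $\mathcal{M}^{\ell}_{y_2}$ the superwords of words in $\mathcal{M}^{\ell}_{y_1}$. -}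

module Defs where

open import Data.Nat using (ℕ; _≤_)
open import Data.List using (List; []; _∷_; _++_; [_]; _∷ʳ_; map; length)
open import Data.List.Membership.Propositional using (_∈_)
open import Data.Maybe using (Maybe; just; nothing)
open import Data.Product using (Σ; ∃; ∃-syntax; _×_; _,_)
open import Data.Sum using (_⊎_)
open import Relation.Nullary using (¬_)
open import Relation.Binary.PropositionalEquality using (_≡_)

-- Words over Σ are  List A.  Words over Σ ∪ {#} are  List (Maybe A),
-- where  nothing  plays the role of the separator  #  (so # ∉ Σ).

module _ {A : Set} where

  ⌜_⌝ : List A → List (Maybe A)
  ⌜ w ⌝ = map just w

  Factor : {B : Set} → List B → List B → Set
  Factor u w = ∃[ p ] ∃[ s ] (p ++ u ++ s ≡ w)

  Prefix : List A → List A → Set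
  Prefix u w = ∃[ t ] (u ++ t ≡ w)

  Suffix : List A → List A → Set
  Suffix u w = ∃[ t ] (t ++ u ≡ w)

  MAW : List (Maybe A) → List A → Set
  MAW y x =
    (∃[ a ] ∃[ u ] ∃[ b ]
       (x ≡ (a ∷ u) ∷ʳ b)
       × Factor ⌜ a ∷ u ⌝ y
       × Factor ⌜ u ∷ʳ b ⌝ y
       × ¬ Factor ⌜ x ⌝ y)
    ⊎ (∃[ c ] (x ≡ [ c ] × ¬ (just c ∈ y)))

  MAWℓ : ℕ → List (Maybe A) → List A → Set
  MAWℓ ℓ y x = MAW y x × length x ≤ ℓ

  RMℓ : ℕ → List (Maybe A) → List (Maybe A) → List A → Set
  RMℓ ℓ y z x = MAWℓ ℓ y x × ¬ (∃[ w ] (MAWℓ ℓ z w × Factor w x))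

{-# OPTIONS --safe #-}
-- Write x = aub with au and ub factors of y₁#y₂. Neither contains #, so each
-- occurs in y₁ or in y₂, and as x is not minimal absent in y₁ or in y₂, one of
-- them, say au, occurs only in y_j and the other only in y_i (i ≠ j). The shortest
-- prefix of au absent from y_i is then minimal absent in y_i, and being a factor
-- of y_j it contains no minimal absent word of y_j; symmetrically, the shortest
-- suffix of ub absent from y_j lies in RM^ℓ of y_j.
module Submission where

open import Defs
open import Data.Nat using (ℕ; _<_; _≤_)
open import Data.Nat.Properties using (≤-trans; m≤m+n; m≤n+m)
open import Data.List using (List; []; _∷_; _++_; [_]; _∷ʳ_; length; initLast; _∷ʳ′_)
open import Data.List.Properties using (++-assoc; ++-identityʳ; map-++; length-++; ∷-injective; ∷ʳ-injective)
open import Data.List.Membership.Propositional using (_∈_)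
open import Data.List.Membership.Propositional.Properties using (∈-++⁺ˡ; ∈-++⁺ʳ; ∈-∃++)
open import Data.List.Relation.Unary.Any using (here)
open import Data.List.Relation.Binary.Pointwise using (Pointwise-≡⇒≡; ≡⇒Pointwise-≡)
open import Data.List.Relation.Binary.Infix.Heterogeneous using (Infix; MkView; toView; fromView)
open import Data.List.Relation.Binary.Infix.Heterogeneous.Properties using (infix?)
open import Data.Maybe using (Maybe; just; nothing)
open import Data.Maybe.Properties using (≡-dec)
open import Data.Product using (∃-syntax; _×_; _,_; proj₁; proj₂; map₂)
open import Data.Sum using (_⊎_; inj₁; inj₂; map₁)
open import Data.Empty using (⊥-elim)
open import Function using (_∘_; flip)
open import Relation.Nullary using (¬_; Dec; yes; no)
open import Relation.Nullary.Decidable using (map′)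
open import Relation.Binary.Definitions using (DecidableEquality)
open import Relation.Binary.PropositionalEquality using (_≡_; refl; sym; trans; cong; subst; module ≡-Reasoning)

infix 4 _⊑_

-- Defs.Factor has the same unfolding but an extra, uninferable implicit argument.
_⊑_ : {B : Set} → List B → List B → Set
u ⊑ w = ∃[ p ] ∃[ s ] (p ++ u ++ s ≡ w)

module _ {B : Set} where

  []⊑ : (w : List B) → [] ⊑ w
  []⊑ w = [] , w , refl

  ⊑-trans : {u v w : List B} → u ⊑ v → v ⊑ w → u ⊑ w
  ⊑-trans {u} (p , s , refl) (p′ , s′ , refl) = p′ ++ p , s ++ s′ , eq
    where
    open ≡-Reasoning
    eq : (p′ ++ p) ++ u ++ s ++ s′ ≡ p′ ++ (p ++ u ++ s) ++ s′
    eq = begin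
      (p′ ++ p) ++ u ++ s ++ s′   ≡⟨ ++-assoc p′ p _ ⟩
      p′ ++ p ++ u ++ s ++ s′     ≡⟨ cong (λ t → p′ ++ p ++ t) (sym (++-assoc u s s′)) ⟩
      p′ ++ p ++ (u ++ s) ++ s′   ≡⟨ cong (p′ ++_) (sym (++-assoc p (u ++ s) s′)) ⟩
      p′ ++ (p ++ u ++ s) ++ s′   ∎

  Prefix⇒⊑ : {u w : List B} → Prefix u w → u ⊑ w
  Prefix⇒⊑ (t , e) = [] , t , e

  Suffix⇒⊑ : {u w : List B} → Suffix u w → u ⊑ w
  Suffix⇒⊑ {u} (t , e) = t , [] , trans (cong (t ++_) (++-identityʳ u)) e

  ⊑-++⁺ˡ : {u y z : List B} → u ⊑ y → u ⊑ y ++ z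
  ⊑-++⁺ˡ {z = z} u⊑y = ⊑-trans u⊑y (Prefix⇒⊑ (z , refl))

  ⊑-++⁺ʳ : {u z : List B} (y : List B) → u ⊑ z → u ⊑ y ++ z
  ⊑-++⁺ʳ y u⊑z = ⊑-trans u⊑z (Suffix⇒⊑ (y , refl))

  ∈⇒[]⊑ : {c : B} {w : List B} → c ∈ w → [ c ] ⊑ w
  ∈⇒[]⊑ c∈w with p , s , e ← ∈-∃++ c∈w = p , s , sym e

  []⊑⇒∈ : {c : B} {w : List B} → [ c ] ⊑ w → c ∈ w
  []⊑⇒∈ {c} (p , s , e) = subst (c ∈_) e (∈-++⁺ʳ p (here refl))

  Prefix-trans : {u v w : List B} → Prefix u v → Prefix v w → Prefix u w
  Prefix-trans {u} (t , refl) (t′ , refl) = t ++ t′ , sym (++-assoc u t t′)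

  Suffix-trans : {u v w : List B} → Suffix u v → Suffix v w → Suffix u w
  Suffix-trans {u} (t , refl) (t′ , refl) = t′ ++ t , ++-assoc t′ t u

  Prefix⇒length≤ : {u w : List B} → Prefix u w → length u ≤ length w
  Prefix⇒length≤ {u} (t , refl) = subst (length u ≤_) (sym (length-++ u)) (m≤m+n _ _)

  Suffix⇒length≤ : {u w : List B} → Suffix u w → length u ≤ length w
  Suffix⇒length≤ {u} (t , refl) = subst (length u ≤_) (sym (length-++ t)) (m≤n+m _ _)

  ⊑? : DecidableEquality B → (u w : List B) → Dec (u ⊑ w)
  ⊑? _≟_ u w = map′ Infix⇒⊑ ⊑⇒Infix (infix? _≟_ u w)
    where
    Infix⇒⊑ : Infix _≡_ u w → u ⊑ w
    Infix⇒⊑ i with MkView p eq s ← toView i = p , s , cong (λ v → p ++ v ++ s) (Pointwise-≡⇒≡ eq)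

    ⊑⇒Infix : u ⊑ w → Infix _≡_ u w
    ⊑⇒Infix (p , s , refl) = fromView (MkView p (≡⇒Pointwise-≡ refl) s)

  shortest-failing-prefix : {P : List B → Set} → ((w : List B) → Dec (P w)) → P [] →
    (w : List B) → ¬ P w → ∃[ p ] ∃[ c ] ∃[ q ] (p ++ c ∷ q ≡ w × P p × ¬ P (p ∷ʳ c))
  shortest-failing-prefix P? P[] [] ¬P[] = ⊥-elim (¬P[] P[])
  shortest-failing-prefix P? P[] (c ∷ w) ¬Pcw with P? [ c ]
  ... | no ¬Pc = [] , c , w , refl , P[] , ¬Pc
  ... | yes Pc with p , c′ , q , refl , Pcp , ¬Pcpc′ ← shortest-failing-prefix (P? ∘ (c ∷_)) Pc w ¬Pcw
    = c ∷ p , c′ , q , refl , Pcp , ¬Pcpc′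

  shortest-failing-suffix : {P : List B → Set} → ((w : List B) → Dec (P w)) → P [] →
    (w : List B) → ¬ P w → ∃[ p ] ∃[ c ] ∃[ q ] (p ++ c ∷ q ≡ w × P q × ¬ P (c ∷ q))
  shortest-failing-suffix P? P[] [] ¬P[] = ⊥-elim (¬P[] P[])
  shortest-failing-suffix P? P[] (c ∷ w) ¬Pcw with P? w
  ... | yes Pw = [] , c , w , refl , Pw , ¬Pcw
  ... | no ¬Pw with p , c′ , q , refl , Pq , ¬Pc′q ← shortest-failing-suffix P? P[] w ¬Pw
    = c ∷ p , c′ , q , refl , Pq , ¬Pc′q

module _ {A : Set} where

  ⊑-⌜⌝-trans : {u w : List A} {y : List (Maybe A)} → u ⊑ w → ⌜ w ⌝ ⊑ y → ⌜ u ⌝ ⊑ y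
  ⊑-⌜⌝-trans {u} {w} (p , s , e) = ⊑-trans (⌜ p ⌝ , ⌜ s ⌝ , eq)
    where
    eq : ⌜ p ⌝ ++ ⌜ u ⌝ ++ ⌜ s ⌝ ≡ ⌜ w ⌝
    eq = trans (cong (⌜ p ⌝ ++_) (sym (map-++ just u s)))
               (trans (sym (map-++ just p (u ++ s))) (cong ⌜_⌝ e))

  Prefix-separator⁻ : (v y : List A) {t : List (Maybe A)} →
    Prefix ⌜ v ⌝ (⌜ y ⌝ ++ nothing ∷ t) → Prefix ⌜ v ⌝ ⌜ y ⌝
  Prefix-separator⁻ [] y _ = ⌜ y ⌝ , refl
  Prefix-separator⁻ (c ∷ v) [] (_ , ())
  Prefix-separator⁻ (c ∷ v) (d ∷ y) (s , e) with refl , e′ ← ∷-injective e =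
    map₂ (cong (just c ∷_)) (Prefix-separator⁻ v y (s , e′))

  ⊑-separator⁻ : (v y : List A) {t : List (Maybe A)} →
    ⌜ v ⌝ ⊑ ⌜ y ⌝ ++ nothing ∷ t → ⌜ v ⌝ ⊑ ⌜ y ⌝ ⊎ ⌜ v ⌝ ⊑ t
  ⊑-separator⁻ v y ([] , s , e) = inj₁ (Prefix⇒⊑ (Prefix-separator⁻ v y (s , e)))
  ⊑-separator⁻ v [] (_ ∷ p , s , e) = inj₂ (p , s , proj₂ (∷-injective e))
  ⊑-separator⁻ v (d ∷ y) (_ ∷ p , s , e) =
    map₁ (⊑-++⁺ʳ [ just d ]) (⊑-separator⁻ v y (p , s , proj₂ (∷-injective e)))

  MAW⇒¬⊑ : {y : List (Maybe A)} (x : List A) → MAW y x → ¬ ⌜ x ⌝ ⊑ y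
  MAW⇒¬⊑ _ (inj₁ (_ , _ , _ , _ , _ , _ , x⋢y)) = x⋢y
  MAW⇒¬⊑ _ (inj₂ (c , refl , c∉y)) = c∉y ∘ []⊑⇒∈

  ⊑⇒MAW-free : {ℓ : ℕ} {z : List (Maybe A)} (p : List A) →
    ⌜ p ⌝ ⊑ z → ¬ (∃[ w ] (MAWℓ ℓ z w × w ⊑ p))
  ⊑⇒MAW-free p p⊑z (w , (w∈M , _) , w⊑p) = MAW⇒¬⊑ w w∈M (⊑-⌜⌝-trans w⊑p p⊑z)

  module _ (_≟_ : DecidableEquality A) {y : List (Maybe A)} where

    private
      occurs? : (w : List A) → Dec (⌜ w ⌝ ⊑ y)
      occurs? w = ⊑? (≡-dec _≟_) ⌜ w ⌝ y

    -- The shortest prefix of a ∷ v absent from y is minimal absent: its proper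
    -- suffixes lie inside v.
    MAW-prefix : (a : A) (v : List A) → ⌜ v ⌝ ⊑ y → ¬ ⌜ a ∷ v ⌝ ⊑ y →
      ∃[ p ] (Prefix p (a ∷ v) × MAW y p)
    MAW-prefix a v v⊑y av⋢y with shortest-failing-prefix occurs? ([]⊑ y) (a ∷ v) av⋢y
    ... | [] , c , q , refl , _ , c⋢y = [ c ] , (q , refl) , inj₂ (c , refl , c⋢y ∘ ∈⇒[]⊑)
    ... | a ∷ r , c , q , refl , ar⊑y , arc⋢y =
      (a ∷ r) ∷ʳ c , (q , ++-assoc (a ∷ r) [ c ] q) , inj₁ (a , r , c , refl , ar⊑y , rc⊑y , arc⋢y)
      where
      rc⊑y : ⌜ r ∷ʳ c ⌝ ⊑ y
      rc⊑y = ⊑-⌜⌝-trans (Prefix⇒⊑ (q , ++-assoc r [ c ] q)) v⊑y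

    MAW-suffix : (v : List A) (b : A) → ⌜ v ⌝ ⊑ y → ¬ ⌜ v ∷ʳ b ⌝ ⊑ y →
      ∃[ s ] (Suffix s (v ∷ʳ b) × MAW y s)
    MAW-suffix v b v⊑y vb⋢y with shortest-failing-suffix occurs? ([]⊑ y) (v ∷ʳ b) vb⋢y
    ... | p , c , q , e , q⊑y , cq⋢y with initLast q
    ...   | [] = [ c ] , (p , e) , inj₂ (c , refl , cq⋢y ∘ ∈⇒[]⊑)
    ...   | r ∷ʳ′ d = c ∷ r ∷ʳ d , (p , e) , inj₁ (c , r , d , refl , cr⊑y , q⊑y , cq⋢y)
      where
      pcr≡v : p ++ c ∷ r ≡ v
      pcr≡v = proj₁ (∷ʳ-injective (p ++ c ∷ r) v (trans (++-assoc p (c ∷ r) [ d ]) e))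

      cr⊑y : ⌜ c ∷ r ⌝ ⊑ y
      cr⊑y = ⊑-⌜⌝-trans (Suffix⇒⊑ (p , pcr≡v)) v⊑y

  module _ (_≟_ : DecidableEquality A) {ℓ : ℕ} {y z : List (Maybe A)} {x : List A} where

    prefix-RM : (a : A) (v : List A) → Prefix (a ∷ v) x → length x ≤ ℓ →
      ⌜ v ⌝ ⊑ y → ¬ ⌜ a ∷ v ⌝ ⊑ y → ⌜ a ∷ v ⌝ ⊑ z → ∃[ p ] (Prefix p x × RMℓ ℓ y z p)
    prefix-RM a v av-prefix x≤ℓ v⊑y av⋢y av⊑z with p , p-prefix , p∈M ← MAW-prefix _≟_ a v v⊑y av⋢y =
      p , px-prefix , (p∈M , ≤-trans (Prefix⇒length≤ px-prefix) x≤ℓ) ,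
      ⊑⇒MAW-free p (⊑-⌜⌝-trans (Prefix⇒⊑ p-prefix) av⊑z)
      where
      px-prefix : Prefix p x
      px-prefix = Prefix-trans p-prefix av-prefix

    suffix-RM : (v : List A) (b : A) → Suffix (v ∷ʳ b) x → length x ≤ ℓ →
      ⌜ v ⌝ ⊑ y → ¬ ⌜ v ∷ʳ b ⌝ ⊑ y → ⌜ v ∷ʳ b ⌝ ⊑ z → ∃[ s ] (Suffix s x × RMℓ ℓ y z s)
    suffix-RM v b vb-suffix x≤ℓ v⊑y vb⋢y vb⊑z with s , s-suffix , s∈M ← MAW-suffix _≟_ v b v⊑y vb⋢y =
      s , sx-suffix , (s∈M , ≤-trans (Suffix⇒length≤ sx-suffix) x≤ℓ) ,
      ⊑⇒MAW-free s (⊑-⌜⌝-trans (Suffix⇒⊑ s-suffix) vb⊑z)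
      where
      sx-suffix : Suffix s x
      sx-suffix = Suffix-trans s-suffix vb-suffix

  Straddles : List (Maybe A) → List (Maybe A) → A → List A → A → Set
  Straddles y z a u b = ⌜ a ∷ u ⌝ ⊑ y × ¬ ⌜ a ∷ u ⌝ ⊑ z × ⌜ u ∷ʳ b ⌝ ⊑ z × ¬ ⌜ u ∷ʳ b ⌝ ⊑ y

  straddling-RM : DecidableEquality A → {ℓ : ℕ} {y z : List (Maybe A)} (a : A) (u : List A) (b : A) →
    length ((a ∷ u) ∷ʳ b) ≤ ℓ → Straddles y z a u b →
    ∃[ p ] ∃[ s ] (Prefix p ((a ∷ u) ∷ʳ b) × RMℓ ℓ z y p × Suffix s ((a ∷ u) ∷ʳ b) × RMℓ ℓ y z s)
  straddling-RM _≟_ a u b x≤ℓ (au⊑y , au⋢z , ub⊑z , ub⋢y)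
    with p , p-prefix , p∈RM ← prefix-RM _≟_ a u ([ b ] , refl) x≤ℓ
                                 (⊑-⌜⌝-trans (Prefix⇒⊑ ([ b ] , refl)) ub⊑z) au⋢z au⊑y
       | s , s-suffix , s∈RM ← suffix-RM _≟_ u b ([ a ] , refl) x≤ℓ
                                 (⊑-⌜⌝-trans (Suffix⇒⊑ ([ a ] , refl)) au⊑y) ub⋢y ub⊑z
    = p , s , p-prefix , p∈RM , s-suffix , s∈RM

  MAW-separated : (y z : List A) {ℓ : ℕ} (x : List A) →
    MAWℓ ℓ (⌜ y ⌝ ++ nothing ∷ ⌜ z ⌝) x → ¬ MAWℓ ℓ ⌜ y ⌝ x → ¬ MAWℓ ℓ ⌜ z ⌝ x →
    ∃[ a ] ∃[ u ] ∃[ b ] (x ≡ (a ∷ u) ∷ʳ b × (Straddles ⌜ y ⌝ ⌜ z ⌝ a u b ⊎ Straddles ⌜ z ⌝ ⌜ y ⌝ a u b))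
  MAW-separated y z _ (inj₂ (c , refl , c∉yz) , x≤ℓ) x∉My _ =
    ⊥-elim (x∉My (inj₂ (c , refl , c∉yz ∘ ∈-++⁺ˡ) , x≤ℓ))
  MAW-separated y z {ℓ} _ (inj₁ (a , u , b , refl , au⊑yz , ub⊑yz , x⋢yz) , x≤ℓ) x∉My x∉Mz =
    a , u , b , refl , separated (⊑-separator⁻ (a ∷ u) y au⊑yz) (⊑-separator⁻ (u ∷ʳ b) y ub⊑yz)
    where
    x = (a ∷ u) ∷ʳ b

    not-both : {w : List (Maybe A)} → ¬ MAWℓ ℓ w x → ¬ ⌜ x ⌝ ⊑ w → ⌜ a ∷ u ⌝ ⊑ w → ¬ ⌜ u ∷ʳ b ⌝ ⊑ w
    not-both x∉M x⋢w au⊑w ub⊑w = x∉M (inj₁ (a , u , b , refl , au⊑w , ub⊑w , x⋢w) , x≤ℓ)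

    not-both-y : ⌜ a ∷ u ⌝ ⊑ ⌜ y ⌝ → ¬ ⌜ u ∷ʳ b ⌝ ⊑ ⌜ y ⌝
    not-both-y = not-both x∉My (x⋢yz ∘ ⊑-++⁺ˡ)

    not-both-z : ⌜ a ∷ u ⌝ ⊑ ⌜ z ⌝ → ¬ ⌜ u ∷ʳ b ⌝ ⊑ ⌜ z ⌝
    not-both-z = not-both x∉Mz (x⋢yz ∘ ⊑-++⁺ʳ ⌜ y ⌝ ∘ ⊑-++⁺ʳ [ nothing ])

    separated : ⌜ a ∷ u ⌝ ⊑ ⌜ y ⌝ ⊎ ⌜ a ∷ u ⌝ ⊑ ⌜ z ⌝ → ⌜ u ∷ʳ b ⌝ ⊑ ⌜ y ⌝ ⊎ ⌜ u ∷ʳ b ⌝ ⊑ ⌜ z ⌝ →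
      Straddles ⌜ y ⌝ ⌜ z ⌝ a u b ⊎ Straddles ⌜ z ⌝ ⌜ y ⌝ a u b
    separated (inj₁ au⊑y) (inj₁ ub⊑y) = ⊥-elim (not-both-y au⊑y ub⊑y)
    separated (inj₂ au⊑z) (inj₂ ub⊑z) = ⊥-elim (not-both-z au⊑z ub⊑z)
    separated (inj₁ au⊑y) (inj₂ ub⊑z) = inj₁ (au⊑y , flip not-both-z ub⊑z , ub⊑z , not-both-y au⊑y)
    separated (inj₂ au⊑z) (inj₁ ub⊑y) = inj₂ (au⊑z , flip not-both-y ub⊑y , ub⊑y , not-both-z au⊑z)

lemma2 : {A : Set} → DecidableEquality A →
    (y₁ y₂ : List A) (ℓ : ℕ) → 0 < ℓ → (x : List A) →
    MAWℓ ℓ (⌜ y₁ ⌝ ++ nothing ∷ ⌜ y₂ ⌝) x →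
    ¬ MAWℓ ℓ ⌜ y₁ ⌝ x → ¬ MAWℓ ℓ ⌜ y₂ ⌝ x →
    (∃[ p ] ∃[ s ] (Prefix p x × RMℓ ℓ ⌜ y₁ ⌝ ⌜ y₂ ⌝ p × Suffix s x × RMℓ ℓ ⌜ y₂ ⌝ ⌜ y₁ ⌝ s))
    ⊎ (∃[ p ] ∃[ s ] (Prefix p x × RMℓ ℓ ⌜ y₂ ⌝ ⌜ y₁ ⌝ p × Suffix s x × RMℓ ℓ ⌜ y₁ ⌝ ⌜ y₂ ⌝ s))
lemma2 _≟_ y₁ y₂ ℓ _ x x∈M x∉M₁ x∉M₂ with MAW-separated y₁ y₂ x x∈M x∉M₁ x∉M₂
... | a , u , b , refl , inj₁ straddles₁₂ = inj₂ (straddling-RM _≟_ a u b (proj₂ x∈M) straddles₁₂)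
... | a , u , b , refl , inj₂ straddles₂₁ = inj₁ (straddling-RM _≟_ a u b (proj₂ x∈M) straddles₂₁)
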